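{- Let $w\ge 3$ and $n$ be positive integers with $n\equiv 1\pmod{w-1}$ and $n(n-1)-n(w-1)(w-2)\equiv(2k+1)(w-1)\pmod{w(w-1)}$ for some integer $k\in[0,\frac{w-3}{2}]$. Then no $(n,2w-2,w)_3$ code of size $B(n)+n$ is balanced, where $B(n)=\left\lfloor\frac{n(n-1-(w-1)(w-2))}{w(w-1)}\right\rfloor$.
   Context: For $\bm u,\bm v\in\{0,1,2\}^n$, the $\ell_1$-distance is $\sum_i|u_i-v_i|$ and the $\ell_1$-weight of $\bm u$ is its distance to $\bm 0$; $supp(\bm u)=\{i:u_i\ne0\}$. An $(n,d,w)_3$ code is a set of vectors in $\{0,1,2\}^n$ each of $\ell_1$-weight $w$, with pairwise $\ell_1$-distances at least $d$. A code is balanced if the supports of its codewords, viewed as cliques in $K_n$ on vertex set $[n]$, form a decomposition of $K_n$ (every pair of distinct positions lies in exactly one support). -}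

module Defs where

open import Data.Nat using (ℕ; zero; suc; _+_; _*_; _∸_; _≤_; _<_; ∣_-_∣)
open import Data.Integer as ℤ using (ℤ; +_; _/ℕ_)
open import Data.Fin using (Fin; toℕ) renaming (zero to fzero; suc to fsuc)
open import Data.List using (List; []; _∷_; length)
open import Data.List.Relation.Unary.AllPairs using (AllPairs)
open import Data.List.Relation.Unary.All using (All)
open import Relation.Binary.PropositionalEquality using (_≡_; _≢_)
open import Relation.Nullary using (¬_; yes; no)
open import Relation.Nullary.Decidable using (⌊_⌋)
open import Data.Bool using (Bool; true; false; _∧_; if_then_else_)
open import Data.Fin using () renaming (_≟_ to _≟F_)
open import Data.Sum using (_⊎_)

Word : ℕ → Set
Word n = Fin n → Fin 3

sumFin : (n : ℕ) → (Fin n → ℕ) → ℕ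
sumFin zero    f = 0
sumFin (suc n) f = f fzero + sumFin n (λ i → f (fsuc i))

dist : {n : ℕ} → Word n → Word n → ℕ
dist {n} u v = sumFin n (λ i → ∣ toℕ (u i) - toℕ (v i) ∣)

weight : {n : ℕ} → Word n → ℕ
weight {n} u = sumFin n (λ i → toℕ (u i))

inSupp : {n : ℕ} → Word n → Fin n → Bool
inSupp u i with u i
... | fzero = false
... | fsuc _ = true

-- Pairwise distance ≥ d between any two list entries (for d ≥ 1 this also
-- forces the entries to be distinct, so the list really is a set).
record IsCode (n d w : ℕ) (C : List (Word n)) : Set where
  field
    weights   : All (λ u → weight u ≡ w) C
    distances : AllPairs (λ u v → d ≤ dist u v) C

coverCount : {n : ℕ} → List (Word n) → Fin n → Fin n → ℕ
coverCount []      i j = 0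
coverCount (u ∷ C) i j =
  (if inSupp u i ∧ inSupp u j then 1 else 0) + coverCount C i j

-- Balanced: the supports, as cliques of K_n, decompose K_n, i.e. every pair
-- of distinct positions lies in exactly one support.
Balanced : {n : ℕ} → List (Word n) → Set
Balanced {n} C = (i j : Fin n) → i ≢ j → coverCount C i j ≡ 1

-- floor division of an integer by a natural (value irrelevant for divisor 0)
floorDiv : ℤ → ℕ → ℤ
floorDiv a zero    = + 0
floorDiv a (suc m) = a /ℕ suc m

B : ℕ → ℕ → ℤ
B w n = floorDiv (+ n ℤ.* ((+ n ℤ.- + 1) ℤ.- (+ (w ∸ 1) ℤ.* + (w ∸ 2)))) (w * (w ∸ 1))

module Submission where

-- Write s and t for the numbers of nonzero entries and of entries 2 of a codeword, so s + t = w.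
-- Balance gives, at each position p, (n - 1) + X_p = (w - 1) deg p, where X_p sums t over the
-- codewords through p; so w - 1 divides X_p.  Distance 2w - 2 forbids two codewords sharing an
-- entry 2, so a position carries at most one 2, and then X_p ≥ w - 1.  Summing over p squeezes
-- Σ s t between (w - 1) Σ t and itself, and double counting yields
--   (w - 1) w |C| = n (n - 1) + 2 (w - 1) Σ t.
-- Writing |C| = B(n) + n, this determines the remainder of n(n - 1 - (w - 1)(w - 2)) modulo
-- w(w - 1) as 2(w - 1)(n - Σ t), while the hypothesis makes it (2k + 1)(w - 1): a parity clash.

open import Defs
open import Data.Nat as ℕ
  using (ℕ; zero; suc; _+_; _*_; _∸_; _≤_; _≥_; _<_; z≤n; s≤s; ∣_-_∣; _⊓_; NonZero; >-nonZero)
open import Data.Nat.Properties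
  using (+-*-semiring; +-comm; +-assoc; +-suc; +-identityʳ; *-suc; *-identityʳ; *-zeroʳ;
         *-distribˡ-+; *-comm; +-cancelˡ-≡; +-cancelˡ-≤; +-mono-≤; +-monoʳ-≤; *-monoʳ-≤;
         *-monoˡ-≤; *-monoˡ-<; *-cancelʳ-≡; ≤-trans; ≤-reflexive; ≤-antisym; suc-injective;
         m≤m+n; m≤n+m; m≤n+m∸n; m≤n⇒m≤1+n; ⊓-glb; ⊔-lub; even≢odd; module ≤-Reasoning)
open import Data.Nat.Divisibility using (_∣_; ∣m+n∣m⇒∣n; m∣m*n; ∣⇒≤; >⇒∤)
import Data.Nat.Tactic.RingSolver as ℕ-Solver
open import Algebra.Properties.Semiring.Sum +-*-semiring
  using (sum; sum-syntax; sum-cong-≗; sum-remove; ∑-distrib-+; ∑-comm; *-distribˡ-sum; *-distribʳ-sum)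
open import Data.Integer as ℤ using (ℤ; +_; _/ℕ_; _%ℕ_)
open import Data.Integer.Properties
  using (pos-*; +-injective; ∣i∣≡0⇒i≡0; i-j≡0⇒i≡j; [+m]-[+n]≡m⊖n; ∣m⊝n∣≤m⊔n)
open import Data.Integer.DivMod using (a≡a%ℕn+[a/ℕn]*n; n%ℕd<d)
open import Data.Integer.Divisibility as ℤD using ()
open import Data.Integer.Divisibility.Signed as Signed using (∣ᵤ⇒∣; ∣⇒∣ᵤ; ∣m∣n⇒∣m-n; ∣n⇒∣m*n; ∣-refl)
open import Data.Integer.Tactic.RingSolver using (solve-∀)
open import Data.Fin using (Fin; toℕ; punchIn) renaming (zero to fzero; suc to fsuc)
open import Data.Fin.Properties using (punchInᵢ≢i)
open import Data.List using (List; []; _∷_; length; lookup)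
open import Data.List.Membership.Propositional.Properties using (∈-lookup)
open import Data.List.Relation.Unary.All as All using (All; []; _∷_)
open import Data.List.Relation.Unary.AllPairs using (AllPairs; []; _∷_)
open import Data.Empty using (⊥-elim)
open import Data.Bool using (_∧_; if_then_else_)
open import Data.Sum using (_⊎_; inj₁; inj₂)
open import Data.Product using (∃-syntax; _×_; _,_)
open import Function using (_∘_)
open import Relation.Binary.PropositionalEquality
  using (_≡_; _≢_; refl; sym; trans; cong; cong₂; subst; module ≡-Reasoning)
open import Relation.Nullary using (¬_)

sumFin≡sum : ∀ n (f : Fin n → ℕ) → sumFin n f ≡ sum f
sumFin≡sum zero    f = refl
sumFin≡sum (suc n) f = cong (_+_ (f fzero)) (sumFin≡sum n (f ∘ fsuc))

sum-mono-≤ : ∀ {n} {f g : Fin n → ℕ} → (∀ i → f i ≤ g i) → sum f ≤ sum g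
sum-mono-≤ {zero}  f≤g = z≤n
sum-mono-≤ {suc n} f≤g = +-mono-≤ (f≤g fzero) (sum-mono-≤ (f≤g ∘ fsuc))

term≤sum : ∀ {n} (f : Fin n → ℕ) i → f i ≤ sum f
term≤sum f fzero    = m≤m+n _ _
term≤sum f (fsuc i) = ≤-trans (term≤sum (f ∘ fsuc) i) (m≤n+m _ _)

sum-const : ∀ n c → ∑[ i < n ] c ≡ n * c
sum-const zero    c = refl
sum-const (suc n) c = cong (_+_ c) (sum-const n c)

sum-ones-except : ∀ {m} (f : Fin (suc m) → ℕ) p →
                  (∀ q → q ≢ p → f q ≡ 1) → sum f ≡ f p + m
sum-ones-except {m} f p ones = begin
  sum f                                 ≡⟨ sum-remove {i = p} f ⟩
  f p + ∑[ j < m ] f (punchIn p j)      ≡⟨ cong (_+_ (f p)) (sum-cong-≗ (λ j → ones _ (punchInᵢ≢i p j))) ⟩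
  f p + ∑[ j < m ] 1                    ≡⟨ cong (_+_ (f p)) (trans (sum-const m 1) (*-identityʳ m)) ⟩
  f p + m                               ∎
  where open ≡-Reasoning

∣m-n∣+2*m⊓n≡m+n : ∀ m n → ∣ m - n ∣ + 2 * (m ⊓ n) ≡ m + n
∣m-n∣+2*m⊓n≡m+n zero    n       = +-identityʳ n
∣m-n∣+2*m⊓n≡m+n (suc m) zero    = refl
∣m-n∣+2*m⊓n≡m+n (suc m) (suc n) = begin
  ∣ m - n ∣ + 2 * suc (m ⊓ n)       ≡⟨ cong (_+_ (∣ m - n ∣)) (*-suc 2 (m ⊓ n)) ⟩
  ∣ m - n ∣ + (2 + 2 * (m ⊓ n))     ≡⟨ +-suc _ _ ⟩
  suc (∣ m - n ∣ + suc (2 * (m ⊓ n))) ≡⟨ cong suc (+-suc _ _) ⟩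
  2 + (∣ m - n ∣ + 2 * (m ⊓ n))     ≡⟨ cong (_+_ 2) (∣m-n∣+2*m⊓n≡m+n m n) ⟩
  2 + (m + n)                       ≡⟨ cong suc (sym (+-suc m n)) ⟩
  suc m + suc n                     ∎
  where open ≡-Reasoning

ind≢0 : Fin 3 → ℕ
ind≢0 fzero    = 0
ind≢0 (fsuc _) = 1

ind≡2 : Fin 3 → ℕ
ind≡2 fzero           = 0
ind≡2 (fsuc fzero)    = 0
ind≡2 (fsuc (fsuc _)) = 1

toℕ≡ind≢0+ind≡2 : ∀ x → toℕ x ≡ ind≢0 x + ind≡2 x
toℕ≡ind≢0+ind≡2 fzero                = refl
toℕ≡ind≢0+ind≡2 (fsuc fzero)         = refl
toℕ≡ind≢0+ind≡2 (fsuc (fsuc fzero))  = refl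

ind≢0-idem : ∀ x → ind≢0 x * ind≢0 x ≡ ind≢0 x
ind≢0-idem fzero    = refl
ind≢0-idem (fsuc _) = refl

ind≡2≡0⊎ind≡2≡1 : ∀ x → ind≡2 x ≡ 0 ⊎ ind≡2 x ≡ 1
ind≡2≡0⊎ind≡2≡1 fzero           = inj₁ refl
ind≡2≡0⊎ind≡2≡1 (fsuc fzero)    = inj₁ refl
ind≡2≡0⊎ind≡2≡1 (fsuc (fsuc _)) = inj₂ refl

ind≡2≡1⇒2≤toℕ : ∀ x → ind≡2 x ≡ 1 → 2 ≤ toℕ x
ind≡2≡1⇒2≤toℕ (fsuc (fsuc fzero)) _ = s≤s (s≤s z≤n)

ind≡2≤ind≢0* : ∀ x {y} → ind≡2 x ≤ y → ind≡2 x ≤ ind≢0 x * y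
ind≡2≤ind≢0* fzero           _   = z≤n
ind≡2≤ind≢0* (fsuc fzero)    _   = z≤n
ind≡2≤ind≢0* (fsuc (fsuc _)) 1≤y = ≤-trans 1≤y (≤-reflexive (sym (+-identityʳ _)))

module _ {n : ℕ} where

  suppSize twoCount : Word n → ℕ
  suppSize u = ∑[ i < n ] ind≢0 (u i)
  twoCount u = ∑[ i < n ] ind≡2 (u i)

  weight≡suppSize+twoCount : ∀ u → weight u ≡ suppSize u + twoCount u
  weight≡suppSize+twoCount u = begin
    weight u                                      ≡⟨ sumFin≡sum n _ ⟩
    ∑[ i < n ] toℕ (u i)                          ≡⟨ sum-cong-≗ (toℕ≡ind≢0+ind≡2 ∘ u) ⟩
    ∑[ i < n ] (ind≢0 (u i) + ind≡2 (u i))        ≡⟨ ∑-distrib-+ (ind≢0 ∘ u) (ind≡2 ∘ u) ⟩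
    suppSize u + twoCount u                       ∎
    where open ≡-Reasoning

  dist+2*overlap≡weight+weight : ∀ u v →
    dist u v + 2 * ∑[ i < n ] (toℕ (u i) ⊓ toℕ (v i)) ≡ weight u + weight v
  dist+2*overlap≡weight+weight u v = begin
    dist u v + 2 * ∑[ i < n ] (x i ⊓ y i)
      ≡⟨ cong₂ _+_ (sumFin≡sum n _) (*-distribˡ-sum 2 (λ i → x i ⊓ y i)) ⟩
    ∑[ i < n ] ∣ x i - y i ∣ + ∑[ i < n ] (2 * (x i ⊓ y i))
      ≡⟨ sym (∑-distrib-+ (λ i → ∣ x i - y i ∣) (λ i → 2 * (x i ⊓ y i))) ⟩
    ∑[ i < n ] (∣ x i - y i ∣ + 2 * (x i ⊓ y i))
      ≡⟨ sum-cong-≗ (λ i → ∣m-n∣+2*m⊓n≡m+n (x i) (y i)) ⟩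
    ∑[ i < n ] (x i + y i)
      ≡⟨ ∑-distrib-+ x y ⟩
    sum x + sum y
      ≡⟨ sym (cong₂ _+_ (sumFin≡sum n x) (sumFin≡sum n y)) ⟩
    weight u + weight v ∎
    where
    open ≡-Reasoning
    x y : Fin n → ℕ
    x = toℕ ∘ u
    y = toℕ ∘ v

  dist+4≤weight+weight : ∀ u v p → ind≡2 (u p) ≡ 1 → ind≡2 (v p) ≡ 1 →
                         dist u v + 4 ≤ weight u + weight v
  dist+4≤weight+weight u v p up≡2 vp≡2 =
    ≤-trans (+-monoʳ-≤ (dist u v) (*-monoʳ-≤ 2 2≤overlap))
            (≤-reflexive (dist+2*overlap≡weight+weight u v))
    where
    2≤overlap : 2 ≤ ∑[ i < n ] (toℕ (u i) ⊓ toℕ (v i))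
    2≤overlap = ≤-trans (⊓-glb (ind≡2≡1⇒2≤toℕ (u p) up≡2) (ind≡2≡1⇒2≤toℕ (v p) vp≡2))
                        (term≤sum (λ i → toℕ (u i) ⊓ toℕ (v i)) p)

2*w∸2≤d⇒d+4≰w+w : ∀ {w d} → 2 * w ∸ 2 ≤ d → ¬ (d + 4 ≤ w + w)
2*w∸2≤d⇒d+4≰w+w {w} {d} 2w∸2≤d d+4≤w+w = 4≰2 (+-cancelˡ-≤ d 4 2 (begin
    d + 4           ≤⟨ d+4≤w+w ⟩
    w + w           ≡⟨ cong (_+_ w) (+-identityʳ w) ⟨
    2 * w           ≤⟨ m≤n+m∸n (2 * w) 2 ⟩
    2 + (2 * w ∸ 2) ≤⟨ +-monoʳ-≤ 2 2w∸2≤d ⟩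
    2 + d           ≡⟨ +-comm 2 d ⟩
    d + 2           ∎))
  where
  open ≤-Reasoning
  4≰2 : ¬ 4 ≤ 2
  4≰2 (s≤s (s≤s ()))

module _ {n w : ℕ} where

  far-codewords-share-no-two : ∀ {u v : Word n} p → weight u ≡ w → weight v ≡ w →
    2 * w ∸ 2 ≤ dist u v → ind≡2 (u p) ≡ 1 → ind≡2 (v p) ≡ 0
  far-codewords-share-no-two {u} {v} p wu wv far up≡1 with ind≡2≡0⊎ind≡2≡1 (v p)
  ... | inj₁ vp≡0 = vp≡0
  ... | inj₂ vp≡1 = ⊥-elim (2*w∸2≤d⇒d+4≰w+w {w} far
    (subst (dist u v + 4 ≤_) (cong₂ _+_ wu wv) (dist+4≤weight+weight u v p up≡1 vp≡1)))

  twos-far-from-two≡0 : ∀ {u : Word n} p → weight u ≡ w → ind≡2 (u p) ≡ 1 → ∀ {C : List (Word n)} →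
    All (λ v → weight v ≡ w) C → All (λ v → 2 * w ∸ 2 ≤ dist u v) C →
    ∑[ j < length C ] ind≡2 (lookup C j p) ≡ 0
  twos-far-from-two≡0 p wu up≡1 []         []         = refl
  twos-far-from-two≡0 p wu up≡1 (wv ∷ wC) (far ∷ fC) =
    cong₂ _+_ (far-codewords-share-no-two p wu wv far up≡1) (twos-far-from-two≡0 p wu up≡1 wC fC)

  at-most-one-two : ∀ {C : List (Word n)} → All (λ u → weight u ≡ w) C →
    AllPairs (λ u v → 2 * w ∸ 2 ≤ dist u v) C →
    ∀ p → ∑[ j < length C ] ind≡2 (lookup C j p) ≤ 1
  at-most-one-two []         []         p = z≤n
  at-most-one-two {u ∷ C} (wu ∷ wC) (fu ∷ fC) p with ind≡2≡0⊎ind≡2≡1 (u p)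
  ... | inj₁ up≡0 = ≤-trans (≤-reflexive (cong (_+ _) up≡0)) (at-most-one-two wC fC p)
  ... | inj₂ up≡1 = ≤-reflexive (cong₂ _+_ up≡1 (twos-far-from-two≡0 p wu up≡1 wC fu))

module _ {n : ℕ} where

  coverIndicator≡ind≢0*ind≢0 : (u : Word n) (i j : Fin n) →
    (if inSupp u i ∧ inSupp u j then 1 else 0) ≡ ind≢0 (u i) * ind≢0 (u j)
  coverIndicator≡ind≢0*ind≢0 u i j with u i | u j
  ... | fzero  | _      = refl
  ... | fsuc _ | fzero  = refl
  ... | fsuc _ | fsuc _ = refl

  coverCount≡∑ : (C : List (Word n)) → ∀ i j →
    coverCount C i j ≡ ∑[ k < length C ] (ind≢0 (lookup C k i) * ind≢0 (lookup C k j))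
  coverCount≡∑ []      i j = refl
  coverCount≡∑ (u ∷ C) i j = cong₂ _+_ (coverIndicator≡ind≢0*ind≢0 u i j) (coverCount≡∑ C i j)

s+t≡1+W⇒s*t≤W*t : ∀ {s t W} → s + t ≡ suc W → s * t ≤ W * t
s+t≡1+W⇒s*t≤W*t {s} {zero}  {W} _ = ≤-reflexive (trans (*-zeroʳ s) (sym (*-zeroʳ W)))
s+t≡1+W⇒s*t≤W*t {s} {suc t} {W} s+t≡1+W =
  *-monoˡ-≤ (suc t) (≤-trans (m≤m+n s t) (≤-reflexive (suc-injective (trans (sym (+-suc s t)) s+t≡1+W))))

b≤1⇒b≤n⇒d∣n⇒d*b≤n : ∀ d {b n} → b ≤ 1 → b ≤ n → d ∣ n → d * b ≤ n
b≤1⇒b≤n⇒d∣n⇒d*b≤n d {zero}     _     _   _   = ≤-trans (≤-reflexive (*-zeroʳ d)) z≤n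
b≤1⇒b≤n⇒d∣n⇒d*b≤n d {suc zero} _     1≤n d∣n =
  ≤-trans (≤-reflexive (*-identityʳ d)) (∣⇒≤ {{>-nonZero 1≤n}} d∣n)
b≤1⇒b≤n⇒d∣n⇒d*b≤n d {suc (suc _)} (s≤s ()) _ _

module Counting {m W K : ℕ} (c : Fin K → Word (suc m))
  (weight-c : ∀ j → weight (c j) ≡ suc W)
  (balanced : ∀ p q → p ≢ q → ∑[ j < K ] (ind≢0 (c j p) * ind≢0 (c j q)) ≡ 1)
  (twos≤1   : ∀ p → ∑[ j < K ] ind≡2 (c j p) ≤ 1)
  (W∣m      : W ∣ m)
  where

  a b : Fin K → Fin (suc m) → ℕ
  a j p = ind≢0 (c j p)
  b j p = ind≡2 (c j p)

  s t : Fin K → ℕ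
  s j = suppSize (c j)
  t j = twoCount (c j)

  degree twosAt X : Fin (suc m) → ℕ
  degree p = ∑[ j < K ] a j p
  twosAt p = ∑[ j < K ] b j p
  X p      = ∑[ j < K ] (a j p * t j)

  totalTwos : ℕ
  totalTwos = ∑[ j < K ] t j

  s+t≡1+W : ∀ j → s j + t j ≡ suc W
  s+t≡1+W j = trans (sym (weight≡suppSize+twoCount (c j))) (weight-c j)

  ∑a*s≡degree+m : ∀ p → ∑[ j < K ] (a j p * s j) ≡ degree p + m
  ∑a*s≡degree+m p = begin
    ∑[ j < K ] (a j p * s j)                       ≡⟨ sum-cong-≗ (λ j → *-distribˡ-sum (a j p) (a j)) ⟩
    ∑[ j < K ] ∑[ q < suc m ] (a j p * a j q)      ≡⟨ ∑-comm (λ j q → a j p * a j q) ⟩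
    ∑[ q < suc m ] ∑[ j < K ] (a j p * a j q)      ≡⟨ sum-ones-except _ p (λ q q≢p → balanced p q (q≢p ∘ sym)) ⟩
    ∑[ j < K ] (a j p * a j p) + m                 ≡⟨ cong (_+ m) (sum-cong-≗ (λ j → ind≢0-idem (c j p))) ⟩
    degree p + m                                   ∎
    where open ≡-Reasoning

  degree+[m+X]≡1+W*degree : ∀ p → degree p + (m + X p) ≡ suc W * degree p
  degree+[m+X]≡1+W*degree p = begin
    degree p + (m + X p)                            ≡⟨ +-assoc (degree p) m (X p) ⟨
    degree p + m + X p                              ≡⟨ cong (_+ X p) (∑a*s≡degree+m p) ⟨
    ∑[ j < K ] (a j p * s j) + X p                  ≡⟨ ∑-distrib-+ (λ j → a j p * s j) (λ j → a j p * t j) ⟨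
    ∑[ j < K ] (a j p * s j + a j p * t j)          ≡⟨ sum-cong-≗ (λ j → *-distribˡ-+ (a j p) (s j) (t j)) ⟨
    ∑[ j < K ] (a j p * (s j + t j))                ≡⟨ sum-cong-≗ (λ j → cong (a j p *_) (s+t≡1+W j)) ⟩
    ∑[ j < K ] (a j p * suc W)                      ≡⟨ *-distribʳ-sum (suc W) (λ j → a j p) ⟨
    degree p * suc W                                ≡⟨ *-comm (degree p) (suc W) ⟩
    suc W * degree p                                ∎
    where open ≡-Reasoning

  m+X≡W*degree : ∀ p → m + X p ≡ W * degree p
  m+X≡W*degree p = +-cancelˡ-≡ (degree p) _ _ (degree+[m+X]≡1+W*degree p)

  W∣X : ∀ p → W ∣ X p
  W∣X p = ∣m+n∣m⇒∣n (subst (W ∣_) (sym (m+X≡W*degree p)) (m∣m*n (degree p))) W∣m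

  -- A codeword with a 2 at p contains p and has at least one 2.
  twosAt≤X : ∀ p → twosAt p ≤ X p
  twosAt≤X p = sum-mono-≤ (λ j → ind≡2≤ind≢0* (c j p) (term≤sum (b j) p))

  ∑X≡∑s*t : ∑[ p < suc m ] X p ≡ ∑[ j < K ] (s j * t j)
  ∑X≡∑s*t = begin
    ∑[ p < suc m ] ∑[ j < K ] (a j p * t j)   ≡⟨ ∑-comm (λ p j → a j p * t j) ⟩
    ∑[ j < K ] ∑[ p < suc m ] (a j p * t j)   ≡⟨ sum-cong-≗ (λ j → *-distribʳ-sum (t j) (a j)) ⟨
    ∑[ j < K ] (s j * t j)                     ∎
    where open ≡-Reasoning

  W*totalTwos≤∑s*t : W * totalTwos ≤ ∑[ j < K ] (s j * t j)
  W*totalTwos≤∑s*t = begin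
    W * totalTwos                              ≡⟨ cong (W *_) (∑-comm b) ⟩
    W * ∑[ p < suc m ] twosAt p                ≡⟨ *-distribˡ-sum W twosAt ⟩
    ∑[ p < suc m ] (W * twosAt p)              ≤⟨ sum-mono-≤ (λ p → b≤1⇒b≤n⇒d∣n⇒d*b≤n W (twos≤1 p) (twosAt≤X p) (W∣X p)) ⟩
    ∑[ p < suc m ] X p                         ≡⟨ ∑X≡∑s*t ⟩
    ∑[ j < K ] (s j * t j)                     ∎
    where open ≤-Reasoning

  ∑s*t≤W*totalTwos : ∑[ j < K ] (s j * t j) ≤ W * totalTwos
  ∑s*t≤W*totalTwos = ≤-trans (sum-mono-≤ (λ j → s+t≡1+W⇒s*t≤W*t {s j} {t j} (s+t≡1+W j)))
                             (≤-reflexive (sym (*-distribˡ-sum W t)))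

  incidence : suc m * m + ∑[ j < K ] (s j * t j) ≡ W * ∑[ j < K ] s j
  incidence = begin
    suc m * m + ∑[ j < K ] (s j * t j)         ≡⟨ cong₂ _+_ (sum-const (suc m) m) ∑X≡∑s*t ⟨
    ∑[ p < suc m ] m + ∑[ p < suc m ] X p       ≡⟨ ∑-distrib-+ (λ _ → m) X ⟨
    ∑[ p < suc m ] (m + X p)                   ≡⟨ sum-cong-≗ m+X≡W*degree ⟩
    ∑[ p < suc m ] (W * degree p)              ≡⟨ *-distribˡ-sum W degree ⟨
    W * ∑[ p < suc m ] degree p                ≡⟨ cong (W *_) (∑-comm a) ⟨
    W * ∑[ j < K ] s j                         ∎
    where open ≡-Reasoning

  size-identity : W * (K * suc W) ≡ suc m * m + (W * totalTwos + W * totalTwos)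
  size-identity = begin
    W * (K * suc W)                              ≡⟨ cong (W *_) (sum-const K (suc W)) ⟨
    W * ∑[ j < K ] suc W                         ≡⟨ cong (W *_) (sum-cong-≗ s+t≡1+W) ⟨
    W * ∑[ j < K ] (s j + t j)                   ≡⟨ cong (W *_) (∑-distrib-+ s t) ⟩
    W * (∑[ j < K ] s j + totalTwos)             ≡⟨ *-distribˡ-+ W _ totalTwos ⟩
    W * ∑[ j < K ] s j + W * totalTwos           ≡⟨ cong (_+ W * totalTwos) incidence ⟨
    suc m * m + ∑[ j < K ] (s j * t j) + W * totalTwos
      ≡⟨ cong (λ x → suc m * m + x + W * totalTwos) (≤-antisym ∑s*t≤W*totalTwos W*totalTwos≤∑s*t) ⟩
    suc m * m + W * totalTwos + W * totalTwos    ≡⟨ +-assoc (suc m * m) _ _ ⟩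
    suc m * m + (W * totalTwos + W * totalTwos)  ∎
    where open ≡-Reasoning

n∣m∧m<n⇒m≡0 : ∀ {m n} → n ∣ m → m < n → m ≡ 0
n∣m∧m<n⇒m≡0 {zero}  _   _   = refl
n∣m∧m<n⇒m≡0 {suc m} n∣m m<n = ⊥-elim (>⇒∤ m<n n∣m)

%ℕ-unique : ∀ z d .{{_ : NonZero d}} {r} → r < d → + d ℤD.∣ z ℤ.- + r → z %ℕ d ≡ r
%ℕ-unique z d {r} r<d d∣z-r = +-injective (i-j≡0⇒i≡j _ _ (∣i∣≡0⇒i≡0 ∣r′-r∣≡0))
  where
  r′ : ℕ
  r′ = z %ℕ d
  z≡r′+qd : z ≡ + r′ ℤ.+ (z /ℕ d) ℤ.* + d
  z≡r′+qd = a≡a%ℕn+[a/ℕn]*n z d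
  r′-r≡ : + r′ ℤ.- + r ≡ (z ℤ.- + r) ℤ.- (z /ℕ d) ℤ.* + d
  r′-r≡ = begin
    + r′ ℤ.- + r                                    ≡⟨ cancel-multiple (+ r′) (+ r) (z /ℕ d) (+ d) ⟩
    (+ r′ ℤ.+ (z /ℕ d) ℤ.* + d) ℤ.- + r ℤ.- (z /ℕ d) ℤ.* + d ≡⟨ cong (λ x → x ℤ.- + r ℤ.- (z /ℕ d) ℤ.* + d) z≡r′+qd ⟨
    z ℤ.- + r ℤ.- (z /ℕ d) ℤ.* + d                  ∎
    where
    open ≡-Reasoning
    cancel-multiple : ∀ a b q e → a ℤ.- b ≡ (a ℤ.+ q ℤ.* e) ℤ.- b ℤ.- q ℤ.* e
    cancel-multiple = solve-∀
  d∣r′-r : + d ℤD.∣ + r′ ℤ.- + r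
  d∣r′-r = ∣⇒∣ᵤ (subst (Signed._∣_ (+ d)) (sym r′-r≡)
             (∣m∣n⇒∣m-n {m = z ℤ.- + r} (∣ᵤ⇒∣ d∣z-r) (∣n⇒∣m*n (z /ℕ d) ∣-refl)))
  ∣r′-r∣<d : ℤ.∣ + r′ ℤ.- + r ∣ < d
  ∣r′-r∣<d = subst (_< d) (cong ℤ.∣_∣ (sym ([+m]-[+n]≡m⊖n r′ r)))
                   (≤-trans (s≤s (∣m⊝n∣≤m⊔n r′ r)) (⊔-lub (n%ℕd<d z d) r<d))
  ∣r′-r∣≡0 : ℤ.∣ + r′ ℤ.- + r ∣ ≡ 0
  ∣r′-r∣≡0 = n∣m∧m<n⇒m≡0 d∣r′-r ∣r′-r∣<d

numerator : ℕ → ℕ → ℤ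
numerator w n = + n ℤ.* ((+ n ℤ.- + 1) ℤ.- (+ (w ∸ 1) ℤ.* + (w ∸ 2)))

module _ (v : ℕ) where

  private
    w W Q : ℕ
    w = 2 + v
    W = 1 + v
    Q = w * W

  numerator%ℕ≡ : ∀ n k → 2 * k + 1 ≤ v →
    + Q ℤD.∣ (+ n ℤ.* (+ n ℤ.- + 1)) ℤ.- (+ n ℤ.* + W ℤ.* + v) ℤ.- (+ (2 * k + 1) ℤ.* + W) →
    numerator w n %ℕ Q ≡ (2 * k + 1) * W
  numerator%ℕ≡ n k 2k+1≤v Q∣ = %ℕ-unique (numerator w n) Q R<Q (subst (+ Q ℤD.∣_) rearrange Q∣)
    where
    R<Q : (2 * k + 1) * W < Q
    R<Q = *-monoˡ-< W (s≤s (m≤n⇒m≤1+n 2k+1≤v))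
    factor : ∀ a b c d → a ℤ.* (a ℤ.- + 1) ℤ.- a ℤ.* b ℤ.* c ℤ.- d ≡ a ℤ.* ((a ℤ.- + 1) ℤ.- b ℤ.* c) ℤ.- d
    factor = solve-∀
    rearrange : (+ n ℤ.* (+ n ℤ.- + 1)) ℤ.- (+ n ℤ.* + W ℤ.* + v) ℤ.- (+ (2 * k + 1) ℤ.* + W)
              ≡ numerator w n ℤ.- + ((2 * k + 1) * W)
    rearrange = trans (factor (+ n) (+ W) (+ v) _) (cong (λ x → numerator w n ℤ.- x) (sym (pos-* (2 * k + 1) W)))

  -- Here B w (suc m) unfolds to the quotient numerator w (suc m) /ℕ Q.
  numerator%ℕ+2WT≡2nW : ∀ m K T → + K ≡ B w (suc m) ℤ.+ + suc m →
    W * (K * w) ≡ suc m * m + (W * T + W * T) →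
    numerator w (suc m) %ℕ Q + (W * T + W * T) ≡ 2 * suc m * W
  numerator%ℕ+2WT≡2nW m K T K≡B+n size = +-injective (begin
    + r ℤ.+ + (W * T + W * T)                         ≡⟨ cong (λ x → + r ℤ.+ x) (cong₂ ℤ._+_ (pos-* W T) (pos-* W T)) ⟩
    + r ℤ.+ 2ŴT̂                                        ≡⟨ regroup (+ r) q (+ m) n̂ ŵ Ŵ (+ T) ⟩
    (+ r ℤ.+ q ℤ.* (ŵ ℤ.* Ŵ)) ℤ.+ (n̂ ℤ.* + m ℤ.+ 2ŴT̂) ℤ.- Ŵ ℤ.* ((q ℤ.+ n̂) ℤ.* ŵ) ℤ.+ (Ŵ ℤ.* n̂ ℤ.* ŵ ℤ.- n̂ ℤ.* + m)
      ≡⟨ cong₂ (λ x y → x ℤ.+ y ℤ.- Ŵ ℤ.* ((q ℤ.+ n̂) ℤ.* ŵ) ℤ.+ (Ŵ ℤ.* n̂ ℤ.* ŵ ℤ.- n̂ ℤ.* + m)) N≡r+qQ size′ ⟨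
    N ℤ.+ Ŵ ℤ.* ((q ℤ.+ n̂) ℤ.* ŵ) ℤ.- Ŵ ℤ.* ((q ℤ.+ n̂) ℤ.* ŵ) ℤ.+ (Ŵ ℤ.* n̂ ℤ.* ŵ ℤ.- n̂ ℤ.* + m)
      ≡⟨ collapse q (+ m) (+ v) ⟩
    + 2 ℤ.* n̂ ℤ.* Ŵ                                   ≡⟨ trans (cong (ℤ._* Ŵ) (pos-* 2 (suc m))) (pos-* (2 * suc m) W) ⟨
    + (2 * suc m * W)                                 ∎)
    where
    open ≡-Reasoning
    N : ℤ
    N = numerator w (suc m)
    r : ℕ
    r = N %ℕ Q
    q : ℤ
    q = N /ℕ Q
    n̂ ŵ Ŵ 2ŴT̂ : ℤ
    n̂ = + suc m
    ŵ = + w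
    Ŵ = + W
    2ŴT̂ = Ŵ ℤ.* + T ℤ.+ Ŵ ℤ.* + T
    N≡r+qQ : N ≡ + r ℤ.+ q ℤ.* (ŵ ℤ.* Ŵ)
    N≡r+qQ = trans (a≡a%ℕn+[a/ℕn]*n N Q) (cong (λ x → + r ℤ.+ q ℤ.* x) (pos-* w W))
    size′ : Ŵ ℤ.* ((q ℤ.+ n̂) ℤ.* ŵ) ≡ n̂ ℤ.* + m ℤ.+ 2ŴT̂
    size′ = begin
      Ŵ ℤ.* ((q ℤ.+ n̂) ℤ.* ŵ)      ≡⟨ cong (λ x → Ŵ ℤ.* (x ℤ.* ŵ)) K≡B+n ⟨
      Ŵ ℤ.* (+ K ℤ.* ŵ)            ≡⟨ trans (pos-* W (K * w)) (cong (Ŵ ℤ.*_) (pos-* K w)) ⟨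
      + (W * (K * w))              ≡⟨ cong +_ size ⟩
      + (suc m * m + (W * T + W * T)) ≡⟨ cong₂ ℤ._+_ (pos-* (suc m) m) (cong₂ ℤ._+_ (pos-* W T) (pos-* W T)) ⟩
      n̂ ℤ.* + m ℤ.+ 2ŴT̂            ∎
    regroup : ∀ r q m n w W T →
      r ℤ.+ (W ℤ.* T ℤ.+ W ℤ.* T)
      ≡ (r ℤ.+ q ℤ.* (w ℤ.* W)) ℤ.+ (n ℤ.* m ℤ.+ (W ℤ.* T ℤ.+ W ℤ.* T)) ℤ.- W ℤ.* ((q ℤ.+ n) ℤ.* w)
        ℤ.+ (W ℤ.* n ℤ.* w ℤ.- n ℤ.* m)
    regroup = solve-∀
    collapse : ∀ q m v → let n = + 1 ℤ.+ m; W = + 1 ℤ.+ v; w = + 1 ℤ.+ W in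
      n ℤ.* ((n ℤ.- + 1) ℤ.- W ℤ.* v) ℤ.+ W ℤ.* ((q ℤ.+ n) ℤ.* w) ℤ.- W ℤ.* ((q ℤ.+ n) ℤ.* w)
        ℤ.+ (W ℤ.* n ℤ.* w ℤ.- n ℤ.* m)
      ≡ + 2 ℤ.* n ℤ.* W
    collapse = solve-∀

odd*W+2WT≢2nW : ∀ k T n W .{{_ : NonZero W}} → (2 * k + 1) * W + (W * T + W * T) ≢ 2 * n * W
odd*W+2WT≢2nW k T n W eq = even≢odd n (k + T) (sym (*-cancelʳ-≡ _ _ W (trans (regroup k T W) eq)))
  where
  regroup : ∀ k T W → suc (2 * (k + T)) * W ≡ (2 * k + 1) * W + (W * T + W * T)
  regroup = ℕ-Solver.solve-∀

theorem3 : (w n : ℕ) → w ≥ 3 → n ≥ 1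
    → (w ∸ 1) ∣ (n ∸ 1)
    → (∃[ k ] (2 * k + 1 ≤ w ∸ 2)
         × ((+ (w * (w ∸ 1))) ℤD.∣ ((+ n ℤ.* (+ n ℤ.- + 1)) ℤ.- (+ n ℤ.* + (w ∸ 1) ℤ.* + (w ∸ 2)) ℤ.- (+ (2 * k + 1) ℤ.* + (w ∸ 1)))))
    → (C : List (Word n)) → IsCode n (2 * w ∸ 2) w C
    → + (length C) ≡ B w n ℤ.+ + n
    → ¬ Balanced C
theorem3 0             _ ()
theorem3 1             _ (s≤s ())
theorem3 2             _ (s≤s (s≤s ()))
theorem3 (suc (suc (suc v))) (suc m) _ _ W∣m (k , 2k+1≤v , Q∣) C code |C|≡B+n balanced =
  odd*W+2WT≢2nW k totalTwos (suc m) W (begin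
    (2 * k + 1) * W + 2WT                     ≡⟨ cong (_+ 2WT) (numerator%ℕ≡ (suc v) (suc m) k 2k+1≤v Q∣) ⟨
    numerator w (suc m) %ℕ (w * W) + 2WT      ≡⟨ numerator%ℕ+2WT≡2nW (suc v) m (length C) totalTwos |C|≡B+n size-identity ⟩
    2 * suc m * W                             ∎)
  where
  w W : ℕ
  w = 3 + v
  W = 2 + v
  open IsCode code
  open Counting (lookup C) (λ j → All.lookup weights (∈-lookup j))
                (λ p q p≢q → trans (sym (coverCount≡∑ C p q)) (balanced p q p≢q))
                (at-most-one-two weights distances) W∣m
  2WT : ℕ
  2WT = W * totalTwos + W * totalTwos
  open ≡-Reasoning
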